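{- Let $\mathcal A$ be any deterministic streaming algorithm that processes sequences of insert and delete operations on items from a set of $n$ items, using fewer than $n$ bits of storage. Then there exist two operation streams, one consisting of matched pairs (every item is inserted and later deleted exactly once, so the operations pair up as insert $x$/delete $x$) and another whose insert and delete operations cannot be matched in such pairs, after which $\mathcal A$ is in the same state; that is, $\mathcal A$ cannot distinguish a stream of matched insert/delete pairs from one that is not matched in pairs.
   Context: A deterministic streaming algorithm has a fixed initial state and processes a stream of operations (here, "insert $x$" and "delete $x$" for items $x$ of an $n$-element set) one at a time, each operation deterministically transforming the current state into a new state, the state being stored in its bits of storage. -}

module Defs where

open import Data.Nat using (ℕ)
open import Data.Fin using (Fin; _≟_)
open import Data.Bool using (Bool)
open import Data.Vec using (Vec)
open import Data.List using (List; []; _∷_; _++_; foldl)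
open import Data.Product using (_×_)
open import Relation.Nullary using (yes; no)
open import Relation.Binary.PropositionalEquality using (_≡_)

data Op (n : ℕ) : Set where
  ins : Fin n → Op n
  del : Fin n → Op n

Stream : ℕ → Set
Stream n = List (Op n)

record StreamingAlgorithm (n s : ℕ) : Set where
  field
    init : Vec Bool s
    step : Vec Bool s → Op n → Vec Bool s

run : ∀ {n s} → StreamingAlgorithm n s → Stream n → Vec Bool s
run A σ = foldl (StreamingAlgorithm.step A) (StreamingAlgorithm.init A) σ

data Kind : Set where
  I D : Kind

proj : ∀ {n} → Fin n → Stream n → List Kind
proj x [] = []
proj x (ins y ∷ σ) with x ≟ y
... | yes _ = I ∷ proj x σ
... | no  _ = proj x σ
proj x (del y ∷ σ) with x ≟ y
... | yes _ = D ∷ proj x σ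
... | no  _ = proj x σ

data OnceThenDeleted : List Kind → Set where
  absent : OnceThenDeleted []
  pair   : OnceThenDeleted (I ∷ D ∷ [])

Matched : ∀ {n} → Stream n → Set
Matched σ = ∀ x → OnceThenDeleted (proj x σ)

-- General pairability: the operations can be paired as (insert x, later delete x),
-- i.e. for each item the projection is a balanced (Dyck) word.
data Balanced : List Kind → Set where
  bal-[] : Balanced []
  bal-nest : ∀ {u v} → Balanced u → Balanced v → Balanced (I ∷ u ++ D ∷ v)

Pairable : ∀ {n} → Stream n → Set
Pairable σ = ∀ x → Balanced (proj x σ)

{-# OPTIONS --safe #-}
-- An algorithm with s < n bits of memory has fewer states than there are
-- subsets of the n items, so by pigeonhole two different subsets U ≠ V leave
-- it in the same state once their members have been inserted.  Deleting the
-- members of U afterwards keeps the two runs in the same state, yet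
-- "insert U, delete U" is matched, while in "insert V, delete U" an item on
-- which U and V differ is only inserted or only deleted.
module Submission where

open import Defs
open import Data.Nat using (ℕ; zero; suc; _<_; _^_; s≤s; z≤n)
open import Data.Nat.Properties using (^-monoʳ-<)
open import Data.Bool using (Bool; true; false; if_then_else_)
import Data.Bool.Properties as Bool
open import Data.Fin using (Fin; zero; suc; _≟_)
open import Data.Fin.Properties using (pigeonhole; <⇒≢; ¬∀⟶∃¬; 2↔Bool; *↔×)
open import Data.Fin.Subset using (Subset)
open import Data.Vec using (Vec; []; _∷_; lookup; tabulate; uncons)
open import Data.Vec.Properties using (tabulate∘lookup; tabulate-cong)
open import Data.List using (List; []; _∷_; _++_; map; foldl)
open import Data.List.Properties using (foldl-++)
open import Data.Product using (Σ; ∃; ∃₂; _×_; _,_; uncurry)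
open import Data.Product.Function.NonDependent.Propositional using (_×-↔_)
open import Function using (_∘_; _↔_; mk↔ₛ′; Inverse; Injection)
open import Function.Properties.Inverse using (↔-sym; ↔-trans; ↔⇒↣)
open import Relation.Nullary using (¬_; yes; no)
open import Relation.Binary.Definitions using (DecidableEquality)
open import Relation.Binary.PropositionalEquality

↔-injective : ∀ {A B : Set} (e : A ↔ B) {x y : A} →
              Inverse.to e x ≡ Inverse.to e y → x ≡ y
↔-injective e = Injection.injective (↔⇒↣ e)

pigeonhole-↔ : ∀ {m n} {A B : Set} → m < n → A ↔ Fin n → B ↔ Fin m →
               (f : A → B) → ∃₂ λ x y → x ≢ y × f x ≡ f y
pigeonhole-↔ m<n A↔n B↔m f
  with i , j , i<j , fi≡fj ← pigeonhole m<n (Inverse.to B↔m ∘ f ∘ Inverse.from A↔n)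
  = Inverse.from A↔n i , Inverse.from A↔n j
  , <⇒≢ i<j ∘ ↔-injective (↔-sym A↔n) , ↔-injective B↔m fi≡fj

Vec-suc↔× : ∀ {A : Set} {n} → Vec A (suc n) ↔ (A × Vec A n)
Vec-suc↔× = mk↔ₛ′ uncons (uncurry _∷_) (λ _ → refl) λ { (x ∷ xs) → refl }

Vec-Bool↔Fin-2^ : ∀ n → Vec Bool n ↔ Fin (2 ^ n)
Vec-Bool↔Fin-2^ zero    = mk↔ₛ′ (λ _ → zero) (λ _ → []) (λ { zero → refl }) (λ { [] → refl })
Vec-Bool↔Fin-2^ (suc n) =
  ↔-trans Vec-suc↔× (↔-trans (↔-sym 2↔Bool ×-↔ Vec-Bool↔Fin-2^ n) (↔-sym *↔×))

lookup-ext : ∀ {A : Set} {n} {u v : Vec A n} →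
             (∀ i → lookup u i ≡ lookup v i) → u ≡ v
lookup-ext {u = u} {v} eq = begin
  u                   ≡⟨ tabulate∘lookup u ⟨
  tabulate (lookup u) ≡⟨ tabulate-cong eq ⟩
  tabulate (lookup v) ≡⟨ tabulate∘lookup v ⟩
  v                   ∎
  where open ≡-Reasoning

∃-lookup-≢ : ∀ {A : Set} {n} → DecidableEquality A → {u v : Vec A n} →
             u ≢ v → ∃ λ i → lookup u i ≢ lookup v i
∃-lookup-≢ {n = n} _≟ᴬ_ {u} {v} u≢v =
  ¬∀⟶∃¬ n _ (λ i → lookup u i ≟ᴬ lookup v i) (u≢v ∘ lookup-ext)

renameOp : ∀ {m n} → (Fin m → Fin n) → Op m → Op n
renameOp ρ (ins x) = ins (ρ x)
renameOp ρ (del x) = del (ρ x)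

proj-++ : ∀ {n} (x : Fin n) σ ρ → proj x (σ ++ ρ) ≡ proj x σ ++ proj x ρ
proj-++ x [] ρ = refl
proj-++ x (ins y ∷ σ) ρ with x ≟ y
... | yes _ = cong (I ∷_) (proj-++ x σ ρ)
... | no  _ = proj-++ x σ ρ
proj-++ x (del y ∷ σ) ρ with x ≟ y
... | yes _ = cong (D ∷_) (proj-++ x σ ρ)
... | no  _ = proj-++ x σ ρ

proj-rename-suc : ∀ {n} (x : Fin n) σ → proj (suc x) (map (renameOp suc) σ) ≡ proj x σ
proj-rename-suc x [] = refl
proj-rename-suc x (ins y ∷ σ) with x ≟ y
... | yes _ = cong (I ∷_) (proj-rename-suc x σ)
... | no  _ = proj-rename-suc x σ
proj-rename-suc x (del y ∷ σ) with x ≟ y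
... | yes _ = cong (D ∷_) (proj-rename-suc x σ)
... | no  _ = proj-rename-suc x σ

proj-zero-rename-suc : ∀ {n} (σ : Stream n) → proj zero (map (renameOp suc) σ) ≡ []
proj-zero-rename-suc [] = refl
proj-zero-rename-suc (ins _ ∷ σ) = proj-zero-rename-suc σ
proj-zero-rename-suc (del _ ∷ σ) = proj-zero-rename-suc σ

op : ∀ {n} → Kind → Fin n → Op n
op I = ins
op D = del

each : ∀ {n} → Kind → Subset n → Stream n
each k []          = []
each k (true ∷ U)  = op k zero ∷ map (renameOp suc) (each k U)
each k (false ∷ U) = map (renameOp suc) (each k U)

once-if : Bool → Kind → List Kind
once-if b k = if b then k ∷ [] else []

proj-each : ∀ {n} k (U : Subset n) x → proj x (each k U) ≡ once-if (lookup U x) k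
proj-each I (true ∷ U)  zero    = cong (I ∷_) (proj-zero-rename-suc (each I U))
proj-each D (true ∷ U)  zero    = cong (D ∷_) (proj-zero-rename-suc (each D U))
proj-each k (false ∷ U) zero    = proj-zero-rename-suc (each k U)
proj-each I (true ∷ U)  (suc x) = trans (proj-rename-suc x (each I U)) (proj-each I U x)
proj-each D (true ∷ U)  (suc x) = trans (proj-rename-suc x (each D U)) (proj-each D U x)
proj-each k (false ∷ U) (suc x) = trans (proj-rename-suc x (each k U)) (proj-each k U x)

insert-delete : ∀ {n} → Subset n → Subset n → Stream n
insert-delete U V = each I U ++ each D V

proj-insert-delete : ∀ {n} (U V : Subset n) x →
  proj x (insert-delete U V) ≡ once-if (lookup U x) I ++ once-if (lookup V x) D
proj-insert-delete U V x = begin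
  proj x (each I U ++ each D V)          ≡⟨ proj-++ x (each I U) (each D V) ⟩
  proj x (each I U) ++ proj x (each D V) ≡⟨ cong₂ _++_ (proj-each I U x) (proj-each D V x) ⟩
  once-if (lookup U x) I ++ once-if (lookup V x) D ∎
  where open ≡-Reasoning

onceThenDeleted-once-if : ∀ b → OnceThenDeleted (once-if b I ++ once-if b D)
onceThenDeleted-once-if true  = pair
onceThenDeleted-once-if false = absent

insert-delete-matched : ∀ {n} (U : Subset n) → Matched (insert-delete U U)
insert-delete-matched U x =
  subst OnceThenDeleted (sym (proj-insert-delete U U x)) (onceThenDeleted-once-if (lookup U x))

¬Balanced-I : ¬ Balanced (I ∷ [])
¬Balanced-I b = not-I b refl
  where
  -- generalising the index lets the unifier split on the first word of bal-nest
  not-I : ∀ {w} → Balanced w → w ≢ I ∷ []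
  not-I (bal-nest {[]}    _ _) ()
  not-I (bal-nest {_ ∷ _} _ _) ()

¬Balanced-D : ¬ Balanced (D ∷ [])
¬Balanced-D ()

¬Balanced-once-if : ∀ b c → b ≢ c → ¬ Balanced (once-if b I ++ once-if c D)
¬Balanced-once-if true  true  b≢c = λ _ → b≢c refl
¬Balanced-once-if false false b≢c = λ _ → b≢c refl
¬Balanced-once-if true  false _   = ¬Balanced-I
¬Balanced-once-if false true  _   = ¬Balanced-D

insert-delete-¬pairable : ∀ {n} (U V : Subset n) x → lookup U x ≢ lookup V x →
                          ¬ Pairable (insert-delete U V)
insert-delete-¬pairable U V x Ux≢Vx pairable =
  ¬Balanced-once-if _ _ Ux≢Vx (subst Balanced (proj-insert-delete U V x) (pairable x))

run-++-cong : ∀ {n s} (A : StreamingAlgorithm n s) {σ σ′} ρ →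
              run A σ ≡ run A σ′ → run A (σ ++ ρ) ≡ run A (σ′ ++ ρ)
run-++-cong A {σ} {σ′} ρ same = begin
  run A (σ ++ ρ)           ≡⟨ foldl-++ step init σ ρ ⟩
  foldl step (run A σ) ρ   ≡⟨ cong (λ state → foldl step state ρ) same ⟩
  foldl step (run A σ′) ρ  ≡⟨ foldl-++ step init σ′ ρ ⟨
  run A (σ′ ++ ρ)          ∎
  where
  open ≡-Reasoning
  open StreamingAlgorithm A

theorem3 : (n s : ℕ) → s < n → (A : StreamingAlgorithm n s) →
    Σ (Stream n) λ σ → Σ (Stream n) λ τ →
      Matched σ × ¬ Pairable τ × run A σ ≡ run A τ
theorem3 n s s<n A
  with U , V , U≢V , sameState ← pigeonhole-↔ (^-monoʳ-< 2 (s≤s (s≤s z≤n)) s<n)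
         (Vec-Bool↔Fin-2^ n) (Vec-Bool↔Fin-2^ s) (run A ∘ each I)
  with x , Ux≢Vx ← ∃-lookup-≢ Bool._≟_ U≢V
  = insert-delete U U , insert-delete V U
  , insert-delete-matched U
  , insert-delete-¬pairable V U x (Ux≢Vx ∘ sym)
  , run-++-cong A {each I U} {each I V} (each D U) sameState
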